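{- Let $\mathcal{A} = \langle A, \{\to_\alpha\}_{\alpha \in I}\rangle$ be an abstract rewrite system, i.e. a set $A$ together with a family of binary relations $\to_\alpha$ on $A$ indexed by a set $I$, and write $\to \,=\, \bigcup_{\alpha\in I} \to_\alpha$. Suppose there exist a well-founded strict order $>$ on $I$ and a quasi-order $\geqslant$ on $I$ (reflexive and transitive) with ${\geqslant}\cdot{>}\cdot{\geqslant} \subseteq {>}$ (it is not required that ${>}\subseteq{\geqslant}$) such that for all $\alpha,\beta \in I$: \[ {\leftarrow_\alpha \cdot \to_\beta} \;\subseteq\; \to_{\curlyvee\alpha}^{*} \cdot \to_{\preceq\beta}^{=} \cdot \to_{\curlyvee\alpha\beta}^{*} \cdot \leftarrow_{\curlyvee\alpha\beta}^{*} \cdot \leftarrow_{\preceq\alpha}^{=} \cdot \leftarrow_{\curlyvee\beta}^{*}. \] Then $\to$ is confluent.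
   Context: Notation (relative to the given pair $(>,\geqslant)$): for $\alpha \in I$, $\to_{\curlyvee\alpha} = \bigcup\{\to_\gamma : \gamma < \alpha\}$; for $\alpha,\beta\in I$, $\to_{\curlyvee\alpha\beta} = \to_{\curlyvee\alpha} \cup \to_{\curlyvee\beta}$; and $\to_{\preceq\alpha} = \bigcup\{\to_\gamma : \gamma \leqslant \alpha \text{ or } \gamma < \alpha\}$, where $\gamma\leqslant\alpha$ means $\alpha\geqslant\gamma$ and $\gamma<\alpha$ means $\alpha>\gamma$. For a relation $R$, $R^*$ is its reflexive-transitive closure, $R^=$ its reflexive closure, $\leftarrow_\alpha$ is the inverse of $\to_\alpha$ (similarly for the other arrows), and $\cdot$ denotes relational composition. A relation $\to$ on $A$ is confluent if $\leftarrow^* \cdot \to^* \subseteq \to^*\cdot\leftarrow^*$. -}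

module Defs where

open import Data.Product using (Σ; ∃; _×_; _,_)
open import Data.Sum using (_⊎_)
open import Relation.Binary.Core using (Rel)
open import Level using (0ℓ)
open import Relation.Binary.Construct.Closure.ReflexiveTransitive using (Star)
open import Relation.Binary.PropositionalEquality using (_≡_)
open import Induction.WellFounded using (WellFounded)
open import Relation.Binary.Definitions using (Reflexive; Transitive)

ARS : Set → Set → Set₁
ARS A I = I → Rel A 0ℓ

_⁻¹ : {A : Set} → Rel A 0ℓ → Rel A 0ℓ
(R ⁻¹) x y = R y x

_·_ : {A : Set} → Rel A 0ℓ → Rel A 0ℓ → Rel A 0ℓ
(R · S) x z = ∃ λ y → R x y × S y z
infixr 5 _·_

_* : {A : Set} → Rel A 0ℓ → Rel A 0ℓ
R * = Star R

_⁼ : {A : Set} → Rel A 0ℓ → Rel A 0ℓ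
(R ⁼) x y = x ≡ y ⊎ R x y

_⊆ᴿ_ : {A : Set} → Rel A 0ℓ → Rel A 0ℓ → Set
R ⊆ᴿ S = ∀ {x y} → R x y → S x y
infix 4 _⊆ᴿ_

⋃ : {A I : Set} → ARS A I → Rel A 0ℓ
⋃ {I = I} R x y = ∃ λ (α : I) → R α x y

⋃[_] : {A I : Set} → (I → Set) → ARS A I → Rel A 0ℓ
⋃[_] {I = I} P R x y = Σ I λ γ → P γ × R γ x y

↝⋎ : {A I : Set} → Rel I 0ℓ → ARS A I → I → Rel A 0ℓ
↝⋎ _>_ R α = ⋃[ (λ γ → α > γ) ] R

↝⋎₂ : {A I : Set} → Rel I 0ℓ → ARS A I → I → I → Rel A 0ℓ
↝⋎₂ _>_ R α β x y = ↝⋎ _>_ R α x y ⊎ ↝⋎ _>_ R β x y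

↝⪯ : {A I : Set} → Rel I 0ℓ → Rel I 0ℓ → ARS A I → I → Rel A 0ℓ
↝⪯ _>_ _≥_ R α = ⋃[ (λ γ → α ≥ γ ⊎ α > γ) ] R

Confluent : {A : Set} → Rel A 0ℓ → Set
Confluent R = ((R ⁻¹) *) · (R *) ⊆ᴿ (R *) · ((R ⁻¹) *)

-- Van Oostrom's decreasing-diagrams argument, measured by multisets of labels. A reduction is
-- paid for by a budget multiset B: each step either spends some m ∈ B with m ≥ or m > its label,
-- or has a label below an element of B that was already spent or released. Two reductions from a
-- common source, paid by M and N, are joined by well-founded induction on M + N in the
-- Dershowitz–Manna extension of >. When both start with a paid step, the local diagram closes the
-- peak; since ≥ · > · ≥ ⊆ >, its sides are paid by the opposite step's label together with labels
-- below its own, so the two peaks between the original reductions and the sides of the local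
-- diagram, and then the peak between the two valleys so obtained, all have smaller measure.

module Submission where

open import Defs
open import Level using (0ℓ)
open import Function using (id; flip)
open import Data.Empty using (⊥-elim)
open import Data.Product using (Σ-syntax; ∃; _×_; _,_)
open import Data.Sum as Sum using (_⊎_; inj₁; inj₂; [_,_]′; map₁)
open import Data.List using (List; []; _∷_; _++_)
open import Data.List.Relation.Unary.All as All using (All; []; _∷_; lookupAny)
import Data.List.Relation.Unary.All.Properties as Allₚ
open import Data.List.Relation.Unary.Any as Any using (Any; here; there)
import Data.List.Relation.Unary.Any.Properties as Anyₚ
open import Data.List.Membership.Propositional using (_∈_)
open import Data.List.Membership.Propositional.Properties using (∈-∃++)
open import Data.List.Relation.Binary.Permutation.Propositional
open import Data.List.Relation.Binary.Permutation.Propositional.Properties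
open import Relation.Binary.Core using (Rel)
open import Relation.Binary.Definitions using (Reflexive; Transitive; Irreflexive)
open import Relation.Binary.PropositionalEquality using (_≡_; refl; sym)
open import Relation.Binary.Construct.Closure.ReflexiveTransitive as Star using (Star; ε; _◅_)
open import Relation.Binary.Construct.Closure.Transitive using (TransClosure; [_]; _∷_; _∷ʳ_; wellFounded)
open import Relation.Unary using (Pred; ∅; _∪_; _⊆_)
open import Induction.WellFounded using (WellFounded; Acc; acc; module Subrelation)
import Algebra.Solver.CommutativeMonoid as CommutativeMonoidSolver

∈⇒↭∷ : {X : Set} {x : X} {xs : List X} → x ∈ xs → ∃ λ ys → xs ↭ x ∷ ys
∈⇒↭∷ {x = x} x∈xs with ∈-∃++ x∈xs
... | us , ws , refl = us ++ ws , shift x us ws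

∷↭++⇒ : {X : Set} {x : X} {xs ys zs : List X} → x ∷ xs ↭ ys ++ zs →
        (∃ λ ys′ → ys ↭ x ∷ ys′ × xs ↭ ys′ ++ zs) ⊎ (∃ λ zs′ → zs ↭ x ∷ zs′ × xs ↭ ys ++ zs′)
∷↭++⇒ {x = x} {ys = ys} {zs} σ with Anyₚ.++⁻ ys (Any-resp-↭ σ (here refl))
... | inj₁ x∈ys with ∈⇒↭∷ x∈ys
...   | ys′ , τ = inj₁ (ys′ , τ , drop-∷ (↭-trans σ (++⁺ʳ zs τ)))
∷↭++⇒ {x = x} {ys = ys} {zs} σ | inj₂ x∈zs with ∈⇒↭∷ x∈zs
...   | zs′ , τ = inj₂ (zs′ , τ , drop-∷ (↭-trans σ (↭-trans (++⁺ˡ ys τ) (shift x ys zs′))))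

-- Lists up to permutation are finite multisets.
module MultisetOrder {I : Set} (_>_ : Rel I 0ℓ) where

  Below : List I → Pred I 0ℓ
  Below K e = Any (_> e) K

  infix 4 _<ₘ₁_ _<ₘ_

  _<ₘ₁_ : Rel (List I) 0ℓ
  N <ₘ₁ M = Σ[ m ∈ I ] Σ[ B ∈ List I ] Σ[ G ∈ List I ] M ↭ m ∷ B × N ↭ G ++ B × All (m >_) G

  _<ₘ_ : Rel (List I) 0ℓ
  N <ₘ M = Σ[ x ∈ I ] Σ[ X ∈ List I ] Σ[ Y ∈ List I ] Σ[ Z ∈ List I ]
           M ↭ (x ∷ X) ++ Z × N ↭ Y ++ Z × All (Below (x ∷ X)) Y

  acc-resp-↭ : ∀ {M M′} → Acc _<ₘ₁_ M → M ↭ M′ → Acc _<ₘ₁_ M′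
  acc-resp-↭ (acc rec) σ = acc λ (m , B , G , π , ρ , m>G) → rec (m , B , G , ↭-trans σ π , ρ , m>G)

  private
    Addable : I → Set
    Addable a = ∀ {N} → Acc _<ₘ₁_ N → Acc _<ₘ₁_ (a ∷ N)

  ++-accessible : ∀ {a G N} → (∀ {b} → a > b → Addable b) → All (a >_) G →
                  Acc _<ₘ₁_ N → Acc _<ₘ₁_ (G ++ N)
  ++-accessible add []          acc-N = acc-N
  ++-accessible add (a>g ∷ a>G) acc-N = add a>g (++-accessible add a>G acc-N)

  ∷-accessible-step : ∀ {a M} → (∀ {b} → a > b → Addable b) →
                      (∀ {N} → N <ₘ₁ M → Acc _<ₘ₁_ (a ∷ N)) →
                      Acc _<ₘ₁_ M → Acc _<ₘ₁_ (a ∷ M)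
  ∷-accessible-step {a} {M} add step acc-M = acc descend
    where
    descend : ∀ {N} → N <ₘ₁ a ∷ M → Acc _<ₘ₁_ N
    descend (m , B , G , π , ρ , m>G) with ∈-resp-↭ (↭-sym π) (here refl)
    ... | here refl = acc-resp-↭ (++-accessible add m>G (acc-resp-↭ acc-M (drop-∷ π))) (↭-sym ρ)
    ... | there m∈M with ∈⇒↭∷ m∈M
    ...   | M′ , τ = acc-resp-↭ (step (m , M′ , G , τ , ↭-refl , m>G))
                                (↭-sym (↭-trans ρ (↭-trans (++⁺ˡ G B↭a∷M′) (shift a G M′))))
      where
      B↭a∷M′ : B ↭ a ∷ M′
      B↭a∷M′ = drop-∷ (↭-trans (↭-sym π) (↭-trans (↭-prep a τ) (↭-swap a m ↭-refl)))

  -- Nested induction: on a along _>_, and inside it on M along _<ₘ₁_.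
  ∷-accessible : ∀ {a} → Acc (flip _>_) a → Addable a
  ∷-accessible (acc rec-a) (acc rec-M) =
    ∷-accessible-step (λ a>b → ∷-accessible (rec-a a>b))
                      (λ N<M → ∷-accessible (acc rec-a) (rec-M N<M))
                      (acc rec-M)

  <ₘ₁-wellFounded : WellFounded (flip _>_) → WellFounded _<ₘ₁_
  <ₘ₁-wellFounded wf []      = acc λ (_ , _ , _ , π , _) → ⊥-elim (¬x∷xs↭[] (↭-sym π))
  <ₘ₁-wellFounded wf (a ∷ M) = ∷-accessible (wf a) (<ₘ₁-wellFounded wf M)

  private
    infix 4 _<ₘ₁⁺_
    _<ₘ₁⁺_ : Rel (List I) 0ℓ
    _<ₘ₁⁺_ = TransClosure _<ₘ₁_

  <ₘ₁⁺-respˡ-↭ : ∀ {N N′ M} → N ↭ N′ → N′ <ₘ₁⁺ M → N <ₘ₁⁺ M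
  <ₘ₁⁺-respˡ-↭ σ [ m , B , G , π , ρ , m>G ]     = [ m , B , G , π , ↭-trans σ ρ , m>G ]
  <ₘ₁⁺-respˡ-↭ σ ((m , B , G , π , ρ , m>G) ∷ t) = (m , B , G , π , ↭-trans σ ρ , m>G) ∷ t

  <ₘ₁⁺-respʳ-↭ : ∀ {N M M′} → M ↭ M′ → N <ₘ₁⁺ M′ → N <ₘ₁⁺ M
  <ₘ₁⁺-respʳ-↭ σ [ m , B , G , π , ρ , m>G ] = [ m , B , G , ↭-trans σ π , ρ , m>G ]
  <ₘ₁⁺-respʳ-↭ σ (s ∷ t)                     = s ∷ <ₘ₁⁺-respʳ-↭ σ t

  Below-∷-partition : ∀ {x X} Y → All (Below (x ∷ X)) Y →
    Σ[ Yₓ ∈ List I ] Σ[ Y′ ∈ List I ] Y ↭ Yₓ ++ Y′ × All (x >_) Yₓ × All (Below X) Y′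
  Below-∷-partition []      []               = [] , [] , ↭-refl , [] , []
  Below-∷-partition (y ∷ Y) (here x>y ∷ below) with Below-∷-partition Y below
  ... | Yₓ , Y′ , σ , x>Yₓ , belowY′ = y ∷ Yₓ , Y′ , ↭-prep y σ , x>y ∷ x>Yₓ , belowY′
  Below-∷-partition (y ∷ Y) (there y∈X ∷ below) with Below-∷-partition Y below
  ... | Yₓ , Y′ , σ , x>Yₓ , belowY′ =
    Yₓ , y ∷ Y′ , ↭-trans (↭-prep y σ) (↭-sym (shift y Yₓ Y′)) , x>Yₓ , y∈X ∷ belowY′

  -- Removing the elements of x ∷ X one at a time, each replaced by the part of Y below it.
  <ₘ-decompose : ∀ x X Y Z → All (Below (x ∷ X)) Y → (Y ++ Z) <ₘ₁⁺ (x ∷ X ++ Z)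
  <ₘ-decompose x [] Y Z below with Below-∷-partition Y below
  ... | Yₓ , [] , σ , x>Yₓ , [] = [ x , Z , Yₓ , ↭-refl , ++⁺ʳ Z (↭-trans σ (++-identityʳ Yₓ)) , x>Yₓ ]
  <ₘ-decompose x (x′ ∷ X) Y Z below with Below-∷-partition Y below
  ... | Yₓ , Y′ , σ , x>Yₓ , belowY′ =
    <ₘ₁⁺-respˡ-↭ (↭-trans (++⁺ʳ Z σ) (↭-trans (++-assoc Yₓ Y′ Z) (shifts Yₓ Y′)))
                 (<ₘ-decompose x′ X Y′ (Yₓ ++ Z) belowY′)
    ∷ʳ (x , (x′ ∷ X) ++ Z , Yₓ , ↭-refl , shifts (x′ ∷ X) Yₓ , x>Yₓ)

  <ₘ⇒<ₘ₁⁺ : ∀ {N M} → N <ₘ M → N <ₘ₁⁺ M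
  <ₘ⇒<ₘ₁⁺ (x , X , Y , Z , σ , ρ , below) =
    <ₘ₁⁺-respˡ-↭ ρ (<ₘ₁⁺-respʳ-↭ σ (<ₘ-decompose x X Y Z below))

  <ₘ-wellFounded : WellFounded (flip _>_) → WellFounded _<ₘ_
  <ₘ-wellFounded wf = Subrelation.wellFounded <ₘ⇒<ₘ₁⁺ (wellFounded _<ₘ₁_ (<ₘ₁-wellFounded wf))

module BudgetedReduction {A I : Set} (R : ARS A I) (_>_ _≥_ : Rel I 0ℓ) (≥-refl : Reflexive _≥_) where

  open MultisetOrder _>_ using (Below)

  _≽_ : Rel I 0ℓ
  a ≽ b = a ≥ b ⊎ a > b

  ≽-refl : Reflexive _≽_
  ≽-refl = inj₁ ≥-refl

  -- A reduction paid for by the budget multiset B: a step labelled γ is either free (γ ∈ F) or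
  -- spends some m ∈ B with m ≽ γ; spending or releasing m makes every label below m free.
  data Budgeted : List I → Pred I 0ℓ → A → A → Set₁ where
    done    : ∀ {B F x} → Budgeted B F x x
    free    : ∀ {B F γ x x′ y} → R γ x x′ → F γ → Budgeted B F x′ y → Budgeted B F x y
    spend   : ∀ {B F m B′ γ x x′ y} → B ↭ m ∷ B′ → R γ x x′ → m ≽ γ →
              Budgeted B′ (F ∪ (m >_)) x′ y → Budgeted B F x y
    release : ∀ {B F m B′ x y} → B ↭ m ∷ B′ →
              Budgeted B′ (F ∪ (m >_)) x y → Budgeted B F x y

  widen : ∀ {B F F′ x y} → F ⊆ F′ → Budgeted B F x y → Budgeted B F′ x y
  widen F⊆F′ done              = done
  widen F⊆F′ (free r γ∈F d)    = free r (F⊆F′ γ∈F) (widen F⊆F′ d)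
  widen F⊆F′ (spend π r m≽γ d) = spend π r m≽γ (widen [ (λ p → inj₁ (F⊆F′ p)) , inj₂ ]′ d)
  widen F⊆F′ (release π d)     = release π (widen [ (λ p → inj₁ (F⊆F′ p)) , inj₂ ]′ d)

  Budgeted-resp-↭ : ∀ {B B′ F x y} → B ↭ B′ → Budgeted B F x y → Budgeted B′ F x y
  Budgeted-resp-↭ σ done              = done
  Budgeted-resp-↭ σ (free r γ∈F d)    = free r γ∈F (Budgeted-resp-↭ σ d)
  Budgeted-resp-↭ σ (spend π r m≽γ d) = spend (↭-trans (↭-sym σ) π) r m≽γ d
  Budgeted-resp-↭ σ (release π d)     = release (↭-trans (↭-sym σ) π) d

  Budgeted⇒Star : ∀ {B F x y} → Budgeted B F x y → Star (⋃ R) x y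
  Budgeted⇒Star done            = ε
  Budgeted⇒Star (free r _ d)    = (_ , r) ◅ Budgeted⇒Star d
  Budgeted⇒Star (spend _ r _ d) = (_ , r) ◅ Budgeted⇒Star d
  Budgeted⇒Star (release _ d)   = Budgeted⇒Star d

  Star⇒Budgeted : ∀ {x y} → Star (⋃ R) x y → Σ[ B ∈ List I ] Budgeted B ∅ x y
  Star⇒Budgeted ε = [] , done
  Star⇒Budgeted ((α , r) ◅ s) with Star⇒Budgeted s
  ... | B , d = α ∷ B , spend ↭-refl r ≽-refl (widen inj₁ d)

  prepend : ∀ {S : Rel A 0ℓ} {B F u u′ w} → S ⊆ᴿ ⋃[ F ] R →
            Star S u u′ → Budgeted B F u′ w → Budgeted B F u w
  prepend S⊆F ε        d = d
  prepend S⊆F (s ◅ ss) d with S⊆F s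
  ... | γ , γ∈F , r = free r γ∈F (prepend S⊆F ss d)

  private
    split-∪ : ∀ {F₀ F H G : Pred I 0ℓ} → F₀ ⊆ F ∪ H → F₀ ∪ G ⊆ (F ∪ G) ∪ H
    split-∪ split (inj₁ p) = [ (λ q → inj₁ (inj₁ q)) , inj₂ ]′ (split p)
    split-∪ split (inj₂ q) = inj₁ (inj₂ q)

  -- Free steps with labels in H are turned into paid ones, their labels joining the budget.
  charge : ∀ {B} {F₀ : Pred I 0ℓ} (F H : Pred I 0ℓ) {x y} → F₀ ⊆ F ∪ H → Budgeted B F₀ x y →
           Σ[ G ∈ List I ] All H G × Budgeted (B ++ G) F x y
  charge F H split done = [] , [] , done
  charge F H split (free {γ = γ} r p d) with split p | charge F H split d
  ... | inj₁ q   | G , hs , d′ = G , hs , free r q d′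
  ... | inj₂ γ∈H | G , hs , d′ =
    γ ∷ G , γ∈H ∷ hs , spend (shift γ _ G) r ≽-refl (widen inj₁ d′)
  charge F H split (spend {m = m} π r m≽γ d)
    with charge (F ∪ (m >_)) H (split-∪ {F = F} {H} {m >_} split) d
  ... | G , hs , d′ = G , hs , spend (++⁺ʳ G π) r m≽γ d′
  charge F H split (release {m = m} π d)
    with charge (F ∪ (m >_)) H (split-∪ {F = F} {H} {m >_} split) d
  ... | G , hs , d′ = G , hs , release (++⁺ʳ G π) d′

  private
    reassoc : ∀ {F G Q : Pred I 0ℓ} → (F ∪ G) ∪ Q ⊆ (F ∪ Q) ∪ G
    reassoc (inj₁ (inj₁ p)) = inj₁ (inj₁ p)
    reassoc (inj₁ (inj₂ p)) = inj₂ p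
    reassoc (inj₂ p)        = inj₁ (inj₂ p)

    collapse : ∀ {F Q : Pred I 0ℓ} {m} → (m ≽_) ⊆ Q → (F ∪ (m >_)) ∪ Q ⊆ F ∪ Q
    collapse m≽⊆Q (inj₁ (inj₁ p)) = inj₁ p
    collapse m≽⊆Q (inj₁ (inj₂ q)) = inj₂ (m≽⊆Q (inj₂ q))
    collapse m≽⊆Q (inj₂ q)        = inj₂ q

  -- The converse: budget labels g whose ≽-down-set lies in Q are dropped, Q becoming free.
  discharge : ∀ {C B G F} {Q : Pred I 0ℓ} {x y} → C ↭ B ++ G → All (λ g → (g ≽_) ⊆ Q) G →
              Budgeted C F x y → Budgeted B (F ∪ Q) x y
  discharge σ gs done           = done
  discharge σ gs (free r p d)   = free r (inj₁ p) (discharge σ gs d)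
  discharge {F = F} {Q} σ gs (spend {m = m} π r m≽γ d) with ∷↭++⇒ (↭-trans (↭-sym π) σ)
  ... | inj₁ (B′ , τ , σ′) = spend τ r m≽γ (widen (reassoc {F} {m >_} {Q}) (discharge σ′ gs d))
  ... | inj₂ (G′ , τ , σ′) with All-resp-↭ τ gs
  ...   | m≽⊆Q ∷ gs′ = free r (inj₂ (m≽⊆Q m≽γ)) (widen (collapse {F} {Q} m≽⊆Q) (discharge σ′ gs′ d))
  discharge {F = F} {Q} σ gs (release {m = m} π d) with ∷↭++⇒ (↭-trans (↭-sym π) σ)
  ... | inj₁ (B′ , τ , σ′) = release τ (widen (reassoc {F} {m >_} {Q}) (discharge σ′ gs d))
  ... | inj₂ (G′ , τ , σ′) with All-resp-↭ τ gs
  ...   | m≽⊆Q ∷ gs′ = widen (collapse {F} {Q} m≽⊆Q) (discharge σ′ gs′ d)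

  private
    split-Below : ∀ {F : Pred I 0ℓ} {B m B′} → B ↭ m ∷ B′ → F ∪ Below B ⊆ (F ∪ (m >_)) ∪ Below B′
    split-Below π (inj₁ p) = inj₁ (inj₁ p)
    split-Below π (inj₂ q) with Any-resp-↭ π q
    ... | here m>e = inj₁ (inj₂ m>e)
    ... | there q′ = inj₂ q′

  release-all : ∀ B₁ {B₂ F x y} → Budgeted B₂ (F ∪ Below B₁) x y → Budgeted (B₁ ++ B₂) F x y
  release-all []                d = widen (λ { (inj₁ p) → p ; (inj₂ ()) }) d
  release-all (b ∷ B₁) {F = F} d = release ↭-refl (release-all B₁ (widen (split-Below {F} ↭-refl) d))

  append : ∀ {B₁ B₂ F x y z} → Budgeted B₁ F x y → Budgeted B₂ (F ∪ Below B₁) y z →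
           Budgeted (B₁ ++ B₂) F x z
  append {B₁} done d₂                      = release-all B₁ d₂
  append (free r p d) d₂                   = free r p (append d d₂)
  append {B₂ = B₂} {F} (spend π r h d) d₂ = spend (++⁺ʳ B₂ π) r h (append d (widen (split-Below {F} π) d₂))
  append {B₂ = B₂} {F} (release π d) d₂   = release (++⁺ʳ B₂ π) (append d (widen (split-Below {F} π) d₂))

module DecreasingDiagrams {A I : Set} (R : ARS A I) (_>_ _≥_ : Rel I 0ℓ)
    (>-wellFounded : WellFounded (flip _>_))
    (>-trans : Transitive _>_)
    (≥-refl : Reflexive _≥_)
    (≥-trans : Transitive _≥_)
    (≥>≥⇒> : ∀ {α β γ δ} → α ≥ β → β > γ → γ ≥ δ → α > δ)
    (local-peak : ∀ α β → ((R α) ⁻¹) · R β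
         ⊆ᴿ ((↝⋎ _>_ R α) *) · ((↝⪯ _>_ _≥_ R β) ⁼) · ((↝⋎₂ _>_ R α β) *)
            · (((↝⋎₂ _>_ R α β) ⁻¹) *) · (((↝⪯ _>_ _≥_ R α) ⁻¹) ⁼)
            · (((↝⋎ _>_ R β) ⁻¹) *)) where

  open MultisetOrder _>_
  open BudgetedReduction R _>_ _≥_ ≥-refl
  private
    module ↭-Solver = CommutativeMonoidSolver (++-commutativeMonoid {A = I})
  open ↭-Solver using (solve; _⊕_; _⊜_)

  ≽-trans : Transitive _≽_
  ≽-trans (inj₁ a≥b) (inj₁ b≥c) = inj₁ (≥-trans a≥b b≥c)
  ≽-trans (inj₁ a≥b) (inj₂ b>c) = inj₂ (≥>≥⇒> a≥b b>c ≥-refl)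
  ≽-trans (inj₂ a>b) (inj₁ b≥c) = inj₂ (≥>≥⇒> ≥-refl a>b b≥c)
  ≽-trans (inj₂ a>b) (inj₂ b>c) = inj₂ (>-trans a>b b>c)

  ≽->-trans : ∀ {a b c} → a ≽ b → b > c → a > c
  ≽->-trans (inj₁ a≥b) b>c = ≥>≥⇒> a≥b b>c ≥-refl
  ≽->-trans (inj₂ a>b) b>c = >-trans a>b b>c

  >-≽-trans : ∀ {a b c} → a > b → b ≽ c → a > c
  >-≽-trans a>b (inj₁ b≥c) = ≥>≥⇒> ≥-refl a>b b≥c
  >-≽-trans a>b (inj₂ b>c) = >-trans a>b b>c

  >⇒≽⊆ : ∀ {a b} {Q : Pred I 0ℓ} → (a >_) ⊆ Q → a > b → (b ≽_) ⊆ Q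
  >⇒≽⊆ a>⊆Q a>b b≽e = a>⊆Q (>-≽-trans a>b b≽e)

  Below-head : ∀ {M m M′} → M ↭ m ∷ M′ → (m >_) ⊆ Below M
  Below-head π m>e = Any-resp-↭ (↭-sym π) (here m>e)

  All>⇒Below⊆> : ∀ {m G} → All (m >_) G → Below G ⊆ (m >_)
  All>⇒Below⊆> m>G e∈↓G with lookupAny m>G e∈↓G
  ... | m>g , g>e = >-trans m>g g>e

  All-Below⇒Below⊆Below : ∀ {J K} → All (Below K) J → Below J ⊆ Below K
  All-Below⇒Below⊆Below J↓K e∈↓J with lookupAny J↓K e∈↓J
  ... | j∈↓K , j>e = Any.map (λ k>j → >-trans k>j j>e) j∈↓K

  Below-replace : ∀ {M m M′ G} → M ↭ m ∷ M′ → All (m >_) G → Below (M′ ++ G) ⊆ Below M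
  Below-replace {M′ = M′} π m>G e∈↓ with Anyₚ.++⁻ M′ e∈↓
  ... | inj₁ e∈↓M′ = Any-resp-↭ (↭-sym π) (there e∈↓M′)
  ... | inj₂ e∈↓G  = Below-head π (All>⇒Below⊆> m>G e∈↓G)

  Join : List I → List I → A → A → Set₁
  Join M N y z = Σ[ v ∈ A ] Budgeted N (Below M) y v × Budgeted M (Below N) z v

  Join-sym : ∀ {M N y z} → Join M N y z → Join N M z y
  Join-sym (v , yv , zv) = v , zv , yv

  Joinable : List I → Set₁
  Joinable L = ∀ M N → L ↭ M ++ N → ∀ {x y z} → Budgeted M ∅ x y → Budgeted N ∅ x z → Join M N y z

  Joinable-below : List I → Set₁
  Joinable-below L = ∀ {L′} → L′ <ₘ L → Joinable L′

  peak-measure : ∀ {L M N m M′ n N′ G₁ G₂} → L ↭ M ++ N → M ↭ m ∷ M′ → N ↭ n ∷ N′ →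
                 All (m >_) G₁ → All (m >_) G₂ → (M′ ++ G₁) ++ (n ∷ G₂) <ₘ L
  peak-measure {m = m} {M′} {n} {N′} {G₁} {G₂} σ π ρ m>G₁ m>G₂ =
    m , N′ , G₁ ++ G₂ , M′ ++ n ∷ [] ,
    ↭-trans σ (↭-trans (++⁺ π ρ) reorder-old) , reorder-new , All.map here (Allₚ.++⁺ m>G₁ m>G₂)
    where
    reorder-old : (m ∷ M′) ++ (n ∷ N′) ↭ (m ∷ N′) ++ (M′ ++ n ∷ [])
    reorder-old = solve 4 (λ m a n b → (m ⊕ a) ⊕ (n ⊕ b) ⊜ (m ⊕ b) ⊕ (a ⊕ n)) ↭-refl
                    (m ∷ []) M′ (n ∷ []) N′
    reorder-new : (M′ ++ G₁) ++ (n ∷ G₂) ↭ (G₁ ++ G₂) ++ (M′ ++ n ∷ [])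
    reorder-new = solve 4 (λ a g n h → (a ⊕ g) ⊕ (n ⊕ h) ⊜ (g ⊕ h) ⊕ (a ⊕ n)) ↭-refl
                    M′ G₁ (n ∷ []) G₂

  valley-measure : ∀ {L M N m M′ n N′ G₁ G₂ H₁ H₂ J₁ J₂} → L ↭ M ++ N → M ↭ m ∷ M′ → N ↭ n ∷ N′ →
                   All (m >_) G₁ → All (m >_) G₂ → All (n >_) H₁ → All (n >_) H₂ →
                   All (Below (n ∷ G₂)) J₁ → All (Below (m ∷ H₁)) J₂ →
                   ((M′ ++ G₁) ++ J₁) ++ ((N′ ++ H₂) ++ J₂) <ₘ L
  valley-measure {m = m} {M′} {n} {N′} {G₁} {G₂} {H₁} {H₂} {J₁} {J₂}
                 σ π ρ m>G₁ m>G₂ n>H₁ n>H₂ J₁↓ J₂↓ =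
    m , n ∷ [] , G₁ ++ J₁ ++ H₂ ++ J₂ , M′ ++ N′ ,
    ↭-trans σ (↭-trans (++⁺ π ρ) reorder-old) , reorder-new ,
    Allₚ.++⁺ (All.map here m>G₁) (Allₚ.++⁺ (All.map via-n∷G₂ J₁↓)
      (Allₚ.++⁺ (All.map (λ n>h → there (here n>h)) n>H₂) (All.map via-m∷H₁ J₂↓)))
    where
    via-n∷G₂ : Below (n ∷ G₂) ⊆ Below (m ∷ n ∷ [])
    via-n∷G₂ (here n>j)  = there (here n>j)
    via-n∷G₂ (there j∈↓) = here (All>⇒Below⊆> m>G₂ j∈↓)
    via-m∷H₁ : Below (m ∷ H₁) ⊆ Below (m ∷ n ∷ [])
    via-m∷H₁ (here m>j)  = here m>j
    via-m∷H₁ (there j∈↓) = there (here (All>⇒Below⊆> n>H₁ j∈↓))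
    reorder-old : (m ∷ M′) ++ (n ∷ N′) ↭ (m ∷ n ∷ []) ++ (M′ ++ N′)
    reorder-old = solve 4 (λ m a n b → (m ⊕ a) ⊕ (n ⊕ b) ⊜ (m ⊕ n) ⊕ (a ⊕ b)) ↭-refl
                    (m ∷ []) M′ (n ∷ []) N′
    reorder-new : ((M′ ++ G₁) ++ J₁) ++ ((N′ ++ H₂) ++ J₂) ↭ (G₁ ++ J₁ ++ H₂ ++ J₂) ++ (M′ ++ N′)
    reorder-new = solve 6 (λ a g j b h k → ((a ⊕ g) ⊕ j) ⊕ ((b ⊕ h) ⊕ k) ⊜ (g ⊕ (j ⊕ (h ⊕ k))) ⊕ (a ⊕ b))
                    ↭-refl M′ G₁ J₁ N′ H₂ J₂

  peak-side : ∀ {m n γ δ y a b c} → m ≽ γ → n ≽ δ →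
              Star (↝⋎ _>_ R γ) y a → ((↝⪯ _>_ _≥_ R δ) ⁼) a b → Star (↝⋎₂ _>_ R γ δ) b c →
              Budgeted (n ∷ []) (∅ ∪ (m >_)) y c
  peak-side {m} {n} {δ = δ} {b = b} {c = c} m≽γ n≽δ y↠a a→b b↠c =
    prepend (λ (e , γ>e , r) → e , inj₂ (≽->-trans m≽γ γ>e) , r) y↠a (middle a→b)
    where
    rest : Budgeted [] ((∅ ∪ (m >_)) ∪ (n >_)) b c
    rest = prepend [ (λ (e , γ>e , r) → e , inj₁ (inj₂ (≽->-trans m≽γ γ>e)) , r)
                   , (λ (e , δ>e , r) → e , inj₂ (≽->-trans n≽δ δ>e) , r) ]′ b↠c done
    middle : ∀ {a} → ((↝⪯ _>_ _≥_ R δ) ⁼) a b → Budgeted (n ∷ []) (∅ ∪ (m >_)) a c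
    middle (inj₁ refl)           = release ↭-refl rest
    middle (inj₂ (e , δ≽e , r)) = spend ↭-refl r (≽-trans n≽δ δ≽e) rest

  valley-leg : ∀ {M m M′ n N′ G₁ G₂ H₁ H₂ J₁ J₂ y vₗ v} → M ↭ m ∷ M′ →
               All (m >_) G₁ → All (m >_) G₂ → All (n >_) H₁ → All (n >_) H₂ →
               All (Below (n ∷ G₂)) J₁ → All (Below (m ∷ H₁)) J₂ →
               Budgeted (n ∷ G₂) (Below (M′ ++ G₁)) y vₗ →
               Budgeted ((N′ ++ H₂) ++ J₂) (Below ((M′ ++ G₁) ++ J₁)) vₗ v →
               Budgeted (n ∷ N′) (Below M) y v
  valley-leg {M} {m} {M′} {n} {N′} {G₁} {G₂} {H₁} {H₂} {J₁} {J₂}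
             π m>G₁ m>G₂ n>H₁ n>H₂ J₁↓ J₂↓ y→vₗ vₗ→v =
    append (widen [ Below-replace π m>G₁ , id ]′ y→vₗ′) (widen free-in-valley vₗ→v′)
    where
    y→vₗ′ : Budgeted (n ∷ []) (Below (M′ ++ G₁) ∪ Below M) _ _
    y→vₗ′ = discharge ↭-refl (All.map (>⇒≽⊆ (Below-head π)) m>G₂) y→vₗ

    dominated-by-m∷H₁ : ∀ {j} → Below (m ∷ H₁) j → (j ≽_) ⊆ Below M ∪ (n >_)
    dominated-by-m∷H₁ (here m>j)  = >⇒≽⊆ {Q = Below M ∪ (n >_)} (λ m>e → inj₁ (Below-head π m>e)) m>j
    dominated-by-m∷H₁ (there j∈↓) = >⇒≽⊆ {Q = Below M ∪ (n >_)} inj₂ (All>⇒Below⊆> n>H₁ j∈↓)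

    vₗ→v′ : Budgeted N′ (Below ((M′ ++ G₁) ++ J₁) ∪ (Below M ∪ (n >_))) _ _
    vₗ→v′ = discharge (++-assoc N′ H₂ J₂)
              (Allₚ.++⁺ (All.map (>⇒≽⊆ inj₂) n>H₂)
                        (All.map dominated-by-m∷H₁ J₂↓))
              vₗ→v

    via-n∷G₂ : Below (n ∷ G₂) ⊆ Below M ∪ Below (n ∷ [])
    via-n∷G₂ (here n>e)  = inj₂ (here n>e)
    via-n∷G₂ (there e∈↓) = inj₁ (Below-head π (All>⇒Below⊆> m>G₂ e∈↓))

    free-in-valley : Below ((M′ ++ G₁) ++ J₁) ∪ (Below M ∪ (n >_)) ⊆ Below M ∪ Below (n ∷ [])
    free-in-valley (inj₁ e∈↓) with Anyₚ.++⁻ (M′ ++ G₁) e∈↓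
    ... | inj₁ e∈↓M′G₁ = inj₁ (Below-replace π m>G₁ e∈↓M′G₁)
    ... | inj₂ e∈↓J₁   = via-n∷G₂ (All-Below⇒Below⊆Below J₁↓ e∈↓J₁)
    free-in-valley (inj₂ (inj₁ e∈↓M)) = inj₁ e∈↓M
    free-in-valley (inj₂ (inj₂ n>e))  = inj₂ (here n>e)

  join-release : ∀ {L} → Joinable-below L → ∀ M N → L ↭ M ++ N → ∀ {m M′ x y z} → M ↭ m ∷ M′ →
                 Budgeted M′ (∅ ∪ (m >_)) x y → Budgeted N ∅ x z → Join M N y z
  join-release ih M N σ {m} {M′} π x→y x→z =
    let (G , m>G , x→y′) = charge ∅ (m >_) id x→y
        (v , y→v , z→v)  = ih (m , [] , G , M′ ++ N , ↭-trans σ (++⁺ʳ N π) ,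
                                 ↭-trans (++-assoc M′ G N) (shifts M′ G) , All.map here m>G)
                              (M′ ++ G) N ↭-refl x→y′ x→z
    in v , widen (Below-replace π m>G) y→v
         , release π (discharge ↭-refl (All.map (>⇒≽⊆ id) m>G) z→v)

  join-peak : ∀ {L} → Joinable-below L → ∀ M N → L ↭ M ++ N →
              ∀ {m M′ n N′ γ δ x y₁ y z₁ z} →
              M ↭ m ∷ M′ → R γ x y₁ → m ≽ γ → Budgeted M′ (∅ ∪ (m >_)) y₁ y →
              N ↭ n ∷ N′ → R δ x z₁ → n ≽ δ → Budgeted N′ (∅ ∪ (n >_)) z₁ z →
              Join M N y z
  join-peak ih M N σ {m} {M′} {n} {N′} {γ} {δ} π x→y₁ m≽γ y₁→y ρ x→z₁ n≽δ z₁→z =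
    let (_ , c₁ , _ , c₂ , _ , c₃ , _ , c₄ , _ , c₅ , c₆) = local-peak γ δ (_ , x→y₁ , x→z₁)
        (G₁ , m>G₁ , y₁→y′) = charge ∅ (m >_) id y₁→y
        (G₂ , m>G₂ , y₁→c)  = charge ∅ (m >_) id (peak-side m≽γ n≽δ c₁ c₂ c₃)
        (H₁ , n>H₁ , z₁→c)  = charge ∅ (n >_) id
                                (peak-side n≽δ m≽γ (Star.reverse id c₆) (map₁ sym c₅) (Star.reverse Sum.swap c₄))
        (H₂ , n>H₂ , z₁→z′) = charge ∅ (n >_) id z₁→z
        (vₗ , y→vₗ , c→vₗ)  = ih (peak-measure σ π ρ m>G₁ m>G₂) (M′ ++ G₁) (n ∷ G₂) ↭-refl y₁→y′ y₁→c
        (vᵣ , c→vᵣ , z→vᵣ)  = ih (peak-measure (↭-trans σ (++-comm M N)) ρ π n>H₂ n>H₁)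
                                 (m ∷ H₁) (N′ ++ H₂) (++-comm (N′ ++ H₂) (m ∷ H₁)) z₁→c z₁→z′
        (J₁ , J₁↓ , c→vₗ′)  = charge ∅ (Below (n ∷ G₂)) inj₂ c→vₗ
        (J₂ , J₂↓ , c→vᵣ′)  = charge ∅ (Below (m ∷ H₁)) inj₂ c→vᵣ
        (v , vₗ→v , vᵣ→v)   = ih (valley-measure σ π ρ m>G₁ m>G₂ n>H₁ n>H₂ J₁↓ J₂↓)
                                 ((M′ ++ G₁) ++ J₁) ((N′ ++ H₂) ++ J₂) ↭-refl c→vₗ′ c→vᵣ′
    in v , Budgeted-resp-↭ (↭-sym ρ) (valley-leg π m>G₁ m>G₂ n>H₁ n>H₂ J₁↓ J₂↓ y→vₗ vₗ→v)
         , Budgeted-resp-↭ (↭-sym π) (valley-leg ρ n>H₂ n>H₁ m>G₂ m>G₁ J₂↓ J₁↓ z→vᵣ vᵣ→v)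

  join-step : ∀ {L} → Joinable-below L → Joinable L
  join-step ih M N σ done                   x→z               = _ , widen (λ ()) x→z , done
  join-step ih M N σ (free _ () _)          x→z
  join-step ih M N σ (release π x→y)        x→z               = join-release ih M N σ π x→y x→z
  join-step ih M N σ x→y@(spend _ _ _ _)    done              = _ , done , widen (λ ()) x→y
  join-step ih M N σ (spend _ _ _ _)        (free _ () _)
  join-step ih M N σ x→y@(spend _ _ _ _)    (release ρ x→z)   =
    Join-sym (join-release ih N M (↭-trans σ (++-comm M N)) ρ x→z x→y)
  join-step ih M N σ (spend π r₁ m≽γ x→y)  (spend ρ r₂ n≽δ x→z) =
    join-peak ih M N σ π r₁ m≽γ x→y ρ r₂ n≽δ x→z

  join : ∀ {L} → Acc _<ₘ_ L → Joinable L
  join (acc rec) = join-step (λ L′<L → join (rec L′<L))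

  confluent : Confluent (⋃ R)
  confluent (_ , x←*y , y→*z) =
    let (M , y→x) = Star⇒Budgeted (Star.reverse id x←*y)
        (N , y→z) = Star⇒Budgeted y→*z
        (v , x→v , z→v) = join (<ₘ-wellFounded >-wellFounded (M ++ N)) M N ↭-refl y→x y→z
    in v , Budgeted⇒Star x→v , Star.reverse id (Budgeted⇒Star z→v)

theorem2 : {A I : Set} (R : ARS A I) (_>_ : Rel I 0ℓ) (_≥_ : Rel I 0ℓ)
    → WellFounded (λ β α → α > β)
    → Irreflexive _≡_ _>_
    → Transitive _>_
    → Reflexive _≥_
    → Transitive _≥_
    → (∀ {α β γ δ} → α ≥ β → β > γ → γ ≥ δ → α > δ)
    → (∀ α β → ((R α) ⁻¹) · R β
         ⊆ᴿ ((↝⋎ _>_ R α) *) · ((↝⪯ _>_ _≥_ R β) ⁼) · ((↝⋎₂ _>_ R α β) *)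
            · (((↝⋎₂ _>_ R α β) ⁻¹) *) · (((↝⪯ _>_ _≥_ R α) ⁻¹) ⁼)
            · (((↝⋎ _>_ R β) ⁻¹) *))
    → Confluent (⋃ R)
theorem2 R _>_ _≥_ >-wellFounded _ >-trans ≥-refl ≥-trans ≥>≥⇒> local-peak =
  DecreasingDiagrams.confluent R _>_ _≥_ >-wellFounded >-trans ≥-refl ≥-trans ≥>≥⇒> local-peak
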